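{- Let $G,H$ be finite digraphs and consider the Seurat game $\mathbf{G}^2(G,H)$. Suppose $\forall$ colours a set $S$ of vertices of one of the graphs and $\exists$ responds by colouring a set $T$ of vertices of the other. If there is a finite sequence $\bar s=(s_1,\ldots,s_n)$ with each $s_i\in\{I,O\}$ such that the tally-spectrum of $\eta_{\bar s}(S)$ (in its graph) differs from the tally-spectrum of $\eta_{\bar s}(T)$ (in its graph), then $\forall$ has a winning strategy from the resulting position.
   Context: Digraphs: finite vertex set $V$ with edges $E\subseteq V\times V$ (loops allowed). For $S\subseteq V$: $\eta_O(S)=S\cup\{v:\exists u\in S,(u,v)\in E\}$, $\eta_I(S)=S\cup\{v:\exists u\in S,(v,u)\in E\}$, and $\eta_{\bar s}=\eta_{s_n}\circ\cdots\circ\eta_{s_1}$. For a vertex $v$ and $Y\subseteq V$: $\tau_Y(v)=(|E\cap(Y\times\{v\})|,|E\cap(\{v\}\times Y)|)$. The tally-sequence $\vec\tau(v)=(t^v_0,t^v_1,\ldots)$ is defined recursively for all vertices simultaneously: $t^v_0=\tau_V(v)$, and $t^v_{k+1}=\tau_{X^v_k}(v)$ where $X^v_k=\{u\in V:(t^u_0,\ldots,t^u_k)=(t^v_0,\ldots,t^v_k)\}$. The tally-spectrum of a set $X$ in $G$ is the multiset of tally-sequences (computed in all of $G$) of the vertices of $X$. Seurat game $\mathbf{G}^k(G,H)$: two players $\forall,\exists$, a set $\mathbf{Col}$ of $k$ colours. A position is a pair of functions $g:\mathbf{Col}\to\wp(G)$, $h:\mathbf{Col}\to\wp(H)$, initially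 all empty. In each of $\omega$ rounds $\forall$ chooses a colour $c$, one of the graphs and a subset of its vertices; $\exists$ then chooses a subset of the other graph; $c$ is then assigned these two sets (erasing its previous use). The palette of a vertex is the set of colours whose set contains it; $P^G$ is the set of vertices of $G$ with palette exactly $P$. $\forall$ wins in round $n$ if at its beginning (C1) some palette $P$ has $P^G$ empty and $P^H$ nonempty or vice versa, or (C2) there are palettes $P_1,P_2$ with an edge from $P_1^G$ to $P_2^G$ but none from $P_1^H$ to $P_2^H$, or vice versa. $\forall$ has a winning strategy from a position if he can guarantee a win in finitely many further rounds. -}

module Defs where

open import Data.Nat using (ℕ; zero; suc; _+_)
open import Data.Bool using (Bool; true; false; _∧_; _∨_; if_then_else_)
open import Data.Fin using (Fin; zero; suc)
open import Data.Fin.Properties using () renaming (_≟_ to _≟ᶠ_)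
open import Data.Product using (Σ; ∃; _×_; _,_; proj₁)
open import Data.Sum using (_⊎_)
open import Data.List using (List; []; _∷_)
import Data.List.Properties as LP
import Data.Product.Properties as PP
import Data.Nat.Properties as NP
open import Relation.Nullary using (¬_)
open import Relation.Nullary.Decidable using (⌊_⌋; does)
open import Relation.Binary.PropositionalEquality using (_≡_)
open import Function.Bundles using (_⤖_; Bijection)

record Digraph : Set where
  field
    n : ℕ
    E : Fin n → Fin n → Bool

open Digraph public

Subset : Digraph → Set
Subset G = Fin (n G) → Bool

anyFin : {m : ℕ} → (Fin m → Bool) → Bool
anyFin {zero} f = false
anyFin {suc m} f = f zero ∨ anyFin (λ i → f (suc i))

countFin : {m : ℕ} → (Fin m → Bool) → ℕ
countFin {zero} f = 0
countFin {suc m} f = (if f zero then 1 else 0) + countFin (λ i → f (suc i))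

data Dir : Set where
  I O : Dir

ηO : (G : Digraph) → Subset G → Subset G
ηO G S v = S v ∨ anyFin (λ u → S u ∧ E G u v)

ηI : (G : Digraph) → Subset G → Subset G
ηI G S v = S v ∨ anyFin (λ u → S u ∧ E G v u)

η : (G : Digraph) → Dir → Subset G → Subset G
η G I = ηI G
η G O = ηO G

-- η_{(s₁,…,sₙ)} = η_{sₙ} ∘ ⋯ ∘ η_{s₁}  (s₁ is applied first)
ηseq : (G : Digraph) → List Dir → Subset G → Subset G
ηseq G [] S = S
ηseq G (s ∷ ss) S = ηseq G ss (η G s S)

τ : (G : Digraph) → Subset G → Fin (n G) → ℕ × ℕ
τ G Y v = countFin (λ u → Y u ∧ E G u v) , countFin (λ u → Y u ∧ E G v u)

_≟ₜ_ : (a b : List (ℕ × ℕ)) → Relation.Nullary.Dec (a ≡ b)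
_≟ₜ_ = LP.≡-dec (PP.≡-dec NP._≟_ NP._≟_)

-- history k v = (t^v_k , t^v_{k-1} , … , t^v_0)  (newest first)
history : (G : Digraph) → ℕ → Fin (n G) → List (ℕ × ℕ)
classOf : (G : Digraph) → ℕ → Fin (n G) → Subset G
classOf G k v u = does (history G k u ≟ₜ history G k v)

history G zero v = τ G (λ _ → true) v ∷ []
history G (suc k) v = τ G (classOf G k v) v ∷ history G k v

tallySeq : (G : Digraph) → Fin (n G) → ℕ → ℕ × ℕ
tallySeq G v zero = τ G (λ _ → true) v
tallySeq G v (suc k) = τ G (classOf G k v) v

Elems : (G : Digraph) → Subset G → Set
Elems G X = Σ (Fin (n G)) (λ v → X v ≡ true)

-- The tally-spectrum of X in G equals that of Y in H (as multisets of
-- tally-sequences): there is a bijection X → Y preserving tally-sequences.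
SameSpectrum : (G : Digraph) → Subset G → (H : Digraph) → Subset H → Set
SameSpectrum G X H Y =
  Σ (Elems G X ⤖ Elems H Y) λ f →
    ∀ (a : Elems G X) (k : ℕ) →
      tallySeq G (proj₁ a) k ≡ tallySeq H (proj₁ (Bijection.to f a)) k

record Position (k : ℕ) (G H : Digraph) : Set where
  constructor pos
  field
    g : Fin k → Subset G
    h : Fin k → Subset H

open Position public

Palette : ℕ → Set
Palette k = Fin k → Bool

HasPalette : {k : ℕ} (G : Digraph) → (Fin k → Subset G) → Fin (n G) → Palette k → Set
HasPalette G col v P = ∀ c → col c v ≡ P c

Occurs : {k : ℕ} (G : Digraph) → (Fin k → Subset G) → Palette k → Set
Occurs G col P = ∃ λ v → HasPalette G col v P

EdgeBetween : {k : ℕ} (G : Digraph) → (Fin k → Subset G) → Palette k → Palette k → Set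
EdgeBetween G col P₁ P₂ =
  ∃ λ u → ∃ λ v → HasPalette G col u P₁ × HasPalette G col v P₂ × E G u v ≡ true

Condition1 : {k : ℕ} {G H : Digraph} → Position k G H → Set
Condition1 {k} {G} {H} p =
  ∃ λ (P : Palette k) →
    (¬ Occurs G (g p) P × Occurs H (h p) P) ⊎ (Occurs G (g p) P × ¬ Occurs H (h p) P)

Condition2 : {k : ℕ} {G H : Digraph} → Position k G H → Set
Condition2 {k} {G} {H} p =
  ∃ λ (P₁ : Palette k) → ∃ λ (P₂ : Palette k) →
    (EdgeBetween G (g p) P₁ P₂ × ¬ EdgeBetween H (h p) P₁ P₂)
    ⊎ (¬ EdgeBetween G (g p) P₁ P₂ × EdgeBetween H (h p) P₁ P₂)

∀WinsNow : {k : ℕ} {G H : Digraph} → Position k G H → Set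
∀WinsNow p = Condition1 p ⊎ Condition2 p

assign : {k : ℕ} {A : Set} → (Fin k → A) → Fin k → A → Fin k → A
assign col c S d = if does (d ≟ᶠ c) then S else col d

data Side : Set where
  inG inH : Side

SetIn : Side → Digraph → Digraph → Set
SetIn inG G H = Subset G
SetIn inH G H = Subset H

SetOther : Side → Digraph → Digraph → Set
SetOther inG G H = Subset H
SetOther inH G H = Subset G

play : {k : ℕ} {G H : Digraph} → Position k G H → Fin k → (σ : Side) →
       SetIn σ G H → SetOther σ G H → Position k G H
play p c inG S T = pos (assign (g p) c S) (assign (h p) c T)
play p c inH S T = pos (assign (g p) c T) (assign (h p) c S)

-- ∀ has a winning strategy from position p: he can force (C1) or (C2)
-- to hold at the beginning of some round after finitely many rounds.
data ∀Wins {k : ℕ} {G H : Digraph} : Position k G H → Set where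
  now  : ∀ {p} → ∀WinsNow p → ∀Wins p
  move : ∀ {p} (c : Fin k) (σ : Side) (S : SetIn σ G H) →
         (∀ (T : SetOther σ G H) → ∀Wins (play p c σ S T)) → ∀Wins p

SpectraDiffer : (σ : Side) (G H : Digraph) → List Dir →
                SetIn σ G H → SetOther σ G H → Set
SpectraDiffer inG G H s S T = ¬ SameSpectrum G (ηseq G s S) H (ηseq H s T)
SpectraDiffer inH G H s S T = ¬ SameSpectrum H (ηseq H s S) G (ηseq G s T)

-- A pair (X, Y) is Winning when ∀ wins from every position in which one of the two colours marks X in G
-- and Y in H; the other colour is then free for ∀ to probe with.  If |X| ≠ |Y|, ∀ marks a subset of the
-- larger set of the smaller size and recurses.  If (η_d X, η_d Y) is Winning then so is (X, Y): ∀ marks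
-- η_d X, and every answer other than η_d Y is refuted by (C1), (C2) or a difference of sizes.  Singletons
-- {a}, {b} with different tally histories are Winning: at the first round where they differ, either the
-- loops at a and b differ, or η_I or η_O of {a} and of {b} meet the history classes of a and b in different
-- numbers of vertices, and a difference of sizes inside history classes lets ∀ isolate a vertex of the
-- wrong class, which is Winning by induction.  Finally the history partition stabilises after n² + 1
-- rounds, so if X and Y had equally many elements in every history class they would have the same
-- tally-spectrum; applied to η_s̄ S and η_s̄ T this gives the theorem.

module Submission where

open import Defs
open import Axiom.UniquenessOfIdentityProofs using (module Decidable⇒UIP)
open import Data.Bool using (Bool; true; false; _∧_; _∨_; not; if_then_else_)
open import Data.Bool.Properties using (∧-identityʳ; ∧-zeroʳ; ∧-comm; ∧-assoc) renaming (_≟_ to _≟ᵇ_)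
open import Data.Empty using (⊥; ⊥-elim)
open import Data.Fin using (Fin; zero; suc; opposite)
open import Data.Fin.Properties using (all?; ¬∀⟶∃¬) renaming (_≟_ to _≟ᶠ_)
open import Data.List using (List; []; _∷_)
open import Data.List.Properties using (∷-injectiveˡ; ∷-injectiveʳ)
open import Data.Nat using (ℕ; zero; suc; _+_; _*_; _≤_; _<_; z≤n; s≤s; _≤′_; ≤′-refl; ≤′-step)
open import Data.Nat.Properties
open import Data.Product using (Σ; ∃-syntax; _×_; _,_; proj₁; proj₂)
open import Data.Sum using (_⊎_; inj₁; inj₂)
open import Data.Sum.Function.Propositional using (_⊎-↔_)
open import Data.Unit using (⊤; tt)
open import Function using (_∘_)
open import Function.Bundles using (_↔_; Inverse; mk↔ₛ′)
open import Function.Properties.Inverse using (↔-refl; ↔-sym; ↔-trans; ↔⇒⤖)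
open import Relation.Binary using (tri<; tri≈; tri>; DecidableEquality)
open import Relation.Binary.PropositionalEquality
open import Relation.Nullary using (¬_; Dec; yes; no)
open import Relation.Nullary.Decidable using (does; dec-true; dec-false)

private
  variable
    m : ℕ

∧-true : ∀ {a b} → a ∧ b ≡ true → a ≡ true × b ≡ true
∧-true {true} {true} _ = refl , refl

∧-intro : ∀ {a b} → a ≡ true → b ≡ true → a ∧ b ≡ true
∧-intro refl refl = refl

true≢false : ∀ {a} → a ≡ true → a ≡ false → ⊥
true≢false refl ()

does-true : ∀ {P : Set} (P? : Dec P) → does P? ≡ true → P
does-true (yes p) _ = p

does-false : ∀ {P : Set} (P? : Dec P) → does P? ≡ false → ¬ P
does-false (no ¬p) _ = ¬p

tail : (Fin (suc m) → Bool) → Fin m → Bool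
tail X i = X (suc i)

infixl 7 _∩_
infixl 6 _─_
infix 4 _⊆_ _≐_

_∩_ : (Fin m → Bool) → (Fin m → Bool) → Fin m → Bool
(X ∩ Y) v = X v ∧ Y v

⁅_⁆ : Fin m → Fin m → Bool
⁅ a ⁆ v = does (v ≟ᶠ a)

_─_ : (Fin m → Bool) → Fin m → Fin m → Bool
(X ─ a) v = X v ∧ not (⁅ a ⁆ v)

_⊆_ : (Fin m → Bool) → (Fin m → Bool) → Set
X ⊆ Y = ∀ i → X i ≡ true → Y i ≡ true

_≐_ : (Fin m → Bool) → (Fin m → Bool) → Set
X ≐ Y = ∀ i → X i ≡ Y i

⁅⁆-self : (a : Fin m) → ⁅ a ⁆ a ≡ true
⁅⁆-self a = dec-true (a ≟ᶠ a) refl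

⁅⁆-true : {a v : Fin m} → ⁅ a ⁆ v ≡ true → v ≡ a
⁅⁆-true {a = a} {v} = does-true (v ≟ᶠ a)

witness-or-empty : (X : Fin m → Bool) → (∃[ i ] X i ≡ true) ⊎ (∀ i → X i ≡ false)
witness-or-empty {zero} X = inj₂ λ ()
witness-or-empty {suc m} X with X zero in x₀ | witness-or-empty (tail X)
... | true  | _ = inj₁ (zero , x₀)
... | false | inj₁ (i , xᵢ) = inj₁ (suc i , xᵢ)
... | false | inj₂ empty = inj₂ λ { zero → x₀ ; (suc i) → empty i }

⊆-or-witness : (X Y : Fin m → Bool) → X ⊆ Y ⊎ ∃[ i ] (X i ≡ true × Y i ≡ false)
⊆-or-witness X Y with witness-or-empty (λ i → X i ∧ not (Y i))
... | inj₁ (i , p) = inj₂ (i , lemma (X i) (Y i) p)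
  where
  lemma : ∀ a b → a ∧ not b ≡ true → a ≡ true × b ≡ false
  lemma true false _ = refl , refl
... | inj₂ none = inj₁ λ i → lemma (X i) (Y i) (none i)
  where
  lemma : ∀ a b → a ∧ not b ≡ false → a ≡ true → b ≡ true
  lemma true true _ _ = refl

⊆-dec : (X Y : Fin m → Bool) → Dec (X ⊆ Y)
⊆-dec X Y with ⊆-or-witness X Y
... | inj₁ X⊆Y = yes X⊆Y
... | inj₂ (i , xᵢ , yᵢ) = no λ X⊆Y → true≢false (X⊆Y i xᵢ) yᵢ

countFin-cong : {X Y : Fin m → Bool} → X ≐ Y → countFin X ≡ countFin Y
countFin-cong {zero} X≐Y = refl
countFin-cong {suc m} X≐Y = cong₂ _+_ (cong (λ b → if b then 1 else 0) (X≐Y zero)) (countFin-cong (λ i → X≐Y (suc i)))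

countFin-empty : {X : Fin m → Bool} → (∀ i → X i ≡ false) → countFin X ≡ 0
countFin-empty {zero} empty = refl
countFin-empty {suc m} empty rewrite empty zero = countFin-empty (λ i → empty (suc i))

∅ : Fin m → Bool
∅ _ = false

countFin-∅ : countFin {m} ∅ ≡ 0
countFin-∅ {m} = countFin-empty {m} {∅} (λ _ → refl)

countFin-witness : (X : Fin m → Bool) → 0 < countFin X → ∃[ i ] X i ≡ true
countFin-witness X 0<∣X∣ with witness-or-empty X
... | inj₁ w = w
... | inj₂ empty = ⊥-elim (<-irrefl (sym (countFin-empty empty)) 0<∣X∣)

countFin-≤ : (X : Fin m → Bool) → countFin X ≤ m
countFin-≤ {zero} X = z≤n
countFin-≤ {suc m} X with X zero
... | true = s≤s (countFin-≤ _)
... | false = m≤n⇒m≤1+n (countFin-≤ _)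

countFin-mono : {X Y : Fin m → Bool} → X ⊆ Y → countFin X ≤ countFin Y
countFin-mono {zero} X⊆Y = z≤n
countFin-mono {suc m} {X} {Y} X⊆Y with X zero in x₀ | Y zero in y₀
... | true | true = s≤s (countFin-mono {X = tail X} {tail Y} (X⊆Y ∘ suc))
... | true | false = ⊥-elim (true≢false (X⊆Y zero x₀) y₀)
... | false | true = m≤n⇒m≤1+n (countFin-mono {X = tail X} {tail Y} (X⊆Y ∘ suc))
... | false | false = countFin-mono {X = tail X} {tail Y} (X⊆Y ∘ suc)

countFin-strict : {X Y : Fin m → Bool} → X ⊆ Y → (i : Fin m) → X i ≡ false → Y i ≡ true →
                  countFin X < countFin Y
countFin-strict {X = X} {Y} X⊆Y zero xᵢ yᵢ rewrite xᵢ | yᵢ = s≤s (countFin-mono {X = tail X} {tail Y} (X⊆Y ∘ suc))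
countFin-strict {X = X} {Y} X⊆Y (suc i) xᵢ yᵢ with X zero in x₀ | Y zero in y₀
... | true | true = s≤s (countFin-strict {X = tail X} {tail Y} (X⊆Y ∘ suc) i xᵢ yᵢ)
... | true | false = ⊥-elim (true≢false (X⊆Y zero x₀) y₀)
... | false | true = m≤n⇒m≤1+n (countFin-strict {X = tail X} {tail Y} (X⊆Y ∘ suc) i xᵢ yᵢ)
... | false | false = countFin-strict {X = tail X} {tail Y} (X⊆Y ∘ suc) i xᵢ yᵢ

countFin-pos : {X : Fin m → Bool} (i : Fin m) → X i ≡ true → 0 < countFin X
countFin-pos {m} {X} i xᵢ = subst (_< countFin X) (countFin-∅ {m}) (countFin-strict {X = ∅} (λ _ ()) i refl xᵢ)

⊆-count-≐ : {X Y : Fin m → Bool} → X ⊆ Y → countFin Y ≤ countFin X → X ≐ Y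
⊆-count-≐ {X = X} {Y} X⊆Y ∣Y∣≤∣X∣ i with X i in xᵢ | Y i in yᵢ
... | true | true = refl
... | true | false = ⊥-elim (true≢false (X⊆Y i xᵢ) yᵢ)
... | false | false = refl
... | false | true = ⊥-elim (<-irrefl refl (<-≤-trans (countFin-strict X⊆Y i xᵢ yᵢ) ∣Y∣≤∣X∣))

countFin-remove : (X : Fin m → Bool) (a : Fin m) → countFin X ≡ countFin (X ─ a) + (if X a then 1 else 0)
countFin-remove X zero rewrite ∧-zeroʳ (X zero) =
  trans (+-comm (if X zero then 1 else 0) (countFin (tail X)))
        (cong (_+ (if X zero then 1 else 0)) (countFin-cong (λ i → sym (∧-identityʳ (X (suc i))))))
countFin-remove X (suc a) rewrite ∧-identityʳ (X zero) =
  trans (cong ((if X zero then 1 else 0) +_) (countFin-remove (tail X) a))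
        (sym (+-assoc (if X zero then 1 else 0) _ _))

countFin-⁅⁆ : (a : Fin m) → countFin ⁅ a ⁆ ≡ 1
countFin-⁅⁆ a rewrite countFin-remove ⁅ a ⁆ a | ⁅⁆-self a = cong (_+ 1) (countFin-empty only-a)
  where
  only-a : ∀ v → (⁅ a ⁆ ─ a) v ≡ false
  only-a v with ⁅ a ⁆ v
  ... | true = refl
  ... | false = refl

singleton-of-count-1 : (D : Fin m → Bool) → countFin D ≡ 1 → ∃[ b ] (D b ≡ true × ⁅ b ⁆ ≐ D)
singleton-of-count-1 D ∣D∣≡1 with countFin-witness D (subst (0 <_) (sym ∣D∣≡1) (s≤s z≤n))
... | b , d_b = b , d_b , ⊆-count-≐ (λ v b≡v → subst (λ u → D u ≡ true) (sym (⁅⁆-true b≡v)) d_b)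
                                     (≤-reflexive (trans ∣D∣≡1 (sym (countFin-⁅⁆ b))))

subset-of-size : (Y : Fin m → Bool) (k : ℕ) → k ≤ countFin Y → ∃[ Z ] (Z ⊆ Y × countFin Z ≡ k)
subset-of-size {zero} Y zero _ = Y , (λ _ p → p) , refl
subset-of-size {suc m} Y k k≤∣Y∣ with Y zero in y₀
subset-of-size {suc m} Y zero _ | _ = ∅ , (λ _ ()) , countFin-∅ {suc m}
subset-of-size {suc m} Y (suc k) (s≤s k≤∣Y∣) | true with subset-of-size (tail Y) k k≤∣Y∣
... | Z , Z⊆Y , ∣Z∣ = (λ { zero → true ; (suc i) → Z i }) ,
                     (λ { zero _ → y₀ ; (suc i) zᵢ → Z⊆Y i zᵢ }) , cong suc ∣Z∣
subset-of-size {suc m} Y (suc k) k≤∣Y∣ | false with subset-of-size (tail Y) (suc k) k≤∣Y∣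
... | Z , Z⊆Y , ∣Z∣ = (λ { zero → false ; (suc i) → Z i }) ,
                     (λ { zero () ; (suc i) zᵢ → Z⊆Y i zᵢ }) , ∣Z∣

countFin-∩-remove : (X F : Fin m → Bool) (x : Fin m) → X x ≡ true →
                    countFin (X ∩ F) ≡ countFin ((X ─ x) ∩ F) + (if F x then 1 else 0)
countFin-∩-remove X F x xₓ = begin
  countFin (X ∩ F)                                        ≡⟨ countFin-remove (X ∩ F) x ⟩
  countFin ((X ∩ F) ─ x) + (if X x ∧ F x then 1 else 0)   ≡⟨ cong₂ _+_ (countFin-cong reorder)
                                                                        (cong (λ b → if b ∧ F x then 1 else 0) xₓ) ⟩
  countFin ((X ─ x) ∩ F) + (if F x then 1 else 0)         ∎
  where
  open ≡-Reasoning
  reorder : (X ∩ F) ─ x ≐ (X ─ x) ∩ F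
  reorder v = trans (∧-assoc (X v) _ _) (trans (cong (X v ∧_) (∧-comm (F v) _)) (sym (∧-assoc (X v) _ _)))

∩-⊆ : (X F : Fin m → Bool) → X ∩ F ⊆ X
∩-⊆ X F i = proj₁ ∘ ∧-true

anyFin-intro : (f : Fin m → Bool) (i : Fin m) → f i ≡ true → anyFin f ≡ true
anyFin-intro f zero fᵢ rewrite fᵢ = refl
anyFin-intro f (suc i) fᵢ with f zero
... | true = refl
... | false = anyFin-intro (tail f) i fᵢ

anyFin-elim : (f : Fin m → Bool) → anyFin f ≡ true → ∃[ i ] f i ≡ true
anyFin-elim {suc m} f any with f zero in f₀
... | true = zero , f₀
... | false with anyFin-elim (tail f) any
...   | i , fᵢ = suc i , fᵢ

anyFin-⁅⁆ : (a : Fin m) (F : Fin m → Bool) → anyFin (λ u → ⁅ a ⁆ u ∧ F u) ≡ F a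
anyFin-⁅⁆ a F with F a in fₐ
... | true = anyFin-intro _ a (∧-intro (⁅⁆-self a) fₐ)
... | false with anyFin (λ u → ⁅ a ⁆ u ∧ F u) in any
...   | false = refl
...   | true with anyFin-elim (λ u → ⁅ a ⁆ u ∧ F u) any
...     | u , p with ∧-true p
...       | ⁅a⁆ᵤ , fᵤ = ⊥-elim (true≢false (subst (λ v → F v ≡ true) (⁅⁆-true ⁅a⁆ᵤ) fᵤ) fₐ)

sumFin : (Fin m → ℕ) → ℕ
sumFin {zero} f = 0
sumFin {suc m} f = f zero + sumFin (f ∘ suc)

sumFin-mono : {f g : Fin m → ℕ} → (∀ i → f i ≤ g i) → sumFin f ≤ sumFin g
sumFin-mono {zero} f≤g = z≤n
sumFin-mono {suc m} f≤g = +-mono-≤ (f≤g zero) (sumFin-mono (f≤g ∘ suc))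

sumFin-strict : {f g : Fin m → ℕ} → (∀ i → f i ≤ g i) → ∀ j → f j < g j → sumFin f < sumFin g
sumFin-strict f≤g zero fⱼ<gⱼ = +-mono-<-≤ fⱼ<gⱼ (sumFin-mono (f≤g ∘ suc))
sumFin-strict f≤g (suc j) fⱼ<gⱼ = +-mono-≤-< (f≤g zero) (sumFin-strict (f≤g ∘ suc) j fⱼ<gⱼ)

sumFin-≤ : (f : Fin m → ℕ) (b : ℕ) → (∀ i → f i ≤ b) → sumFin f ≤ m * b
sumFin-≤ {zero} f b f≤b = z≤n
sumFin-≤ {suc m} f b f≤b = +-mono-≤ (f≤b zero) (sumFin-≤ (f ∘ suc) b (f≤b ∘ suc))

-- Label-preserving bijections

Members : (Fin m → Bool) → Set
Members {m} X = Σ (Fin m) λ v → X v ≡ true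

members-≡ : {X : Fin m → Bool} {a b : Members X} → proj₁ a ≡ proj₁ b → a ≡ b
members-≡ {a = v , p} {.v , q} refl = cong (v ,_) (Decidable⇒UIP.≡-irrelevant _≟ᵇ_ p q)

members-split : (X : Fin m → Bool) (x : Fin m) → X x ≡ true → Members X ↔ (⊤ ⊎ Members (X ─ x))
members-split X x xₓ = mk↔ₛ′ to from to∘from from∘to
  where
  pick : ∀ v → X v ≡ true → Dec (v ≡ x) → ⊤ ⊎ Members (X ─ x)
  pick v xᵥ (yes _) = inj₁ tt
  pick v xᵥ (no v≢x) = inj₂ (v , ∧-intro xᵥ (cong not (dec-false (v ≟ᶠ x) v≢x)))
  to : Members X → ⊤ ⊎ Members (X ─ x)
  to (v , xᵥ) = pick v xᵥ (v ≟ᶠ x)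
  from : ⊤ ⊎ Members (X ─ x) → Members X
  from (inj₁ _) = x , xₓ
  from (inj₂ (v , p)) = v , proj₁ (∧-true p)
  to∘from : ∀ b → to (from b) ≡ b
  to∘from (inj₁ _) with x ≟ᶠ x
  ... | yes _ = refl
  ... | no x≢x = ⊥-elim (x≢x refl)
  to∘from (inj₂ (v , p)) = pick-removed v p (v ≟ᶠ x)
    where
    pick-removed : ∀ v (p : (X ─ x) v ≡ true) (v≟x : Dec (v ≡ x)) → pick v (proj₁ (∧-true p)) v≟x ≡ inj₂ (v , p)
    pick-removed v p (yes refl) = ⊥-elim (true≢false (proj₂ (∧-true p)) (cong not (⁅⁆-self x)))
    pick-removed v p (no _) = cong inj₂ (members-≡ refl)
  from∘to : ∀ a → from (to a) ≡ a
  from∘to (v , xᵥ) with v ≟ᶠ x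
  ... | yes refl = members-≡ refl
  ... | no _ = members-≡ refl

LabelledBijection : ∀ {A : Set} {m m′} → (Fin m → A) → (Fin m′ → A) → (Fin m → Bool) → (Fin m′ → Bool) → Set
LabelledBijection ι ι′ X Y = Σ (Members X ↔ Members Y) λ f → ∀ a → ι (proj₁ a) ≡ ι′ (proj₁ (Inverse.to f a))

fibre : ∀ {A : Set} → DecidableEquality A → (Fin m → A) → A → Fin m → Bool
fibre _≟ᴬ_ ι σ v = does (ι v ≟ᴬ σ)

LabelledBijection-extend : ∀ {A : Set} {m m′} {ι : Fin m → A} {ι′ : Fin m′ → A} {X Y} {x y} →
                           (xₓ : X x ≡ true) (y_y : Y y ≡ true) → ι x ≡ ι′ y →
                           LabelledBijection ι ι′ (X ─ x) (Y ─ y) → LabelledBijection ι ι′ X Y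
LabelledBijection-extend {ι = ι} {ι′} {X} {Y} {x} {y} xₓ y_y ιx≡ι′y (f , f-labels) = bijection , labels
  where
  bijection = ↔-trans (members-split X x xₓ) (↔-trans (↔-refl ⊎-↔ f) (↔-sym (members-split Y y y_y)))
  labels : ∀ a → ι (proj₁ a) ≡ ι′ (proj₁ (Inverse.to bijection a))
  labels (v , xᵥ) with v ≟ᶠ x
  ... | yes refl = ιx≡ι′y
  ... | no _ = f-labels _

module _ {A : Set} (_≟ᴬ_ : DecidableEquality A) where

  fibre-self : (ι : Fin m → A) (v : Fin m) → fibre _≟ᴬ_ ι (ι v) v ≡ true
  fibre-self ι v = dec-true (ι v ≟ᴬ ι v) refl

  fibre-label : (ι : Fin m → A) {σ : A} {v : Fin m} → fibre _≟ᴬ_ ι σ v ≡ true → ι v ≡ σ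
  fibre-label ι {σ} {v} = does-true (ι v ≟ᴬ σ)

  FibreCountsAgree : ∀ {m m′} → (Fin m → A) → (Fin m′ → A) → (Fin m → Bool) → (Fin m′ → Bool) → A → Set
  FibreCountsAgree ι ι′ X Y σ = countFin (X ∩ fibre _≟ᴬ_ ι σ) ≡ countFin (Y ∩ fibre _≟ᴬ_ ι′ σ)

  FibreCountsAgree-remove : ∀ {m m′} (ι : Fin m → A) (ι′ : Fin m′ → A) {X Y x y} → X x ≡ true → Y y ≡ true →
                            ι x ≡ ι′ y → (∀ σ → FibreCountsAgree ι ι′ X Y σ) →
                            ∀ σ → FibreCountsAgree ι ι′ (X ─ x) (Y ─ y) σ
  FibreCountsAgree-remove ι ι′ {X} {Y} {x} {y} xₓ y_y ιx≡ι′y agree σ = +-cancelʳ-≡ _ _ _ (begin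
    countFin ((X ─ x) ∩ Fσ) + (if Fσ x then 1 else 0)    ≡⟨ countFin-∩-remove X Fσ x xₓ ⟨
    countFin (X ∩ Fσ)                                     ≡⟨ agree σ ⟩
    countFin (Y ∩ F′σ)                                    ≡⟨ countFin-∩-remove Y F′σ y y_y ⟩
    countFin ((Y ─ y) ∩ F′σ) + (if F′σ y then 1 else 0)
      ≡⟨ cong (λ τ → countFin ((Y ─ y) ∩ F′σ) + (if does (τ ≟ᴬ σ) then 1 else 0)) ιx≡ι′y ⟨
    countFin ((Y ─ y) ∩ F′σ) + (if Fσ x then 1 else 0)   ∎)
    where
    open ≡-Reasoning
    Fσ = fibre _≟ᴬ_ ι σ
    F′σ = fibre _≟ᴬ_ ι′ σ

  fibre-counts-bijection : ∀ {m m′} (ι : Fin m → A) (ι′ : Fin m′ → A) k X Y → countFin X ≡ k →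
                           (∀ σ → FibreCountsAgree ι ι′ X Y σ) → LabelledBijection ι ι′ X Y
  fibre-counts-bijection ι ι′ zero X Y ∣X∣≡0 agree =
    mk↔ₛ′ (λ (v , xᵥ) → ⊥-elim (∉X v xᵥ)) (λ (w , y_w) → ⊥-elim (∉Y w y_w))
          (λ (w , y_w) → ⊥-elim (∉Y w y_w)) (λ (v , xᵥ) → ⊥-elim (∉X v xᵥ)) ,
    λ (v , xᵥ) → ⊥-elim (∉X v xᵥ)
    where
    ∉X : ∀ v → X v ≡ true → ⊥
    ∉X v xᵥ = <-irrefl (sym ∣X∣≡0) (countFin-pos v xᵥ)
    ∉Y : ∀ w → Y w ≡ true → ⊥
    ∉Y w y_w = <-irrefl refl (<-≤-trans (countFin-pos w (∧-intro y_w (fibre-self ι′ w)))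
                 (≤-trans (≤-reflexive (sym (agree (ι′ w)))) (≤-trans (countFin-mono (∩-⊆ X _)) (≤-reflexive ∣X∣≡0))))
  fibre-counts-bijection ι ι′ (suc k) X Y ∣X∣≡1+k agree
    with countFin-witness X (subst (0 <_) (sym ∣X∣≡1+k) (s≤s z≤n))
  ... | x , xₓ with countFin-witness (Y ∩ fibre _≟ᴬ_ ι′ (ι x))
                      (subst (0 <_) (agree (ι x)) (countFin-pos x (∧-intro xₓ (fibre-self ι x))))
  ...   | y , yσ with ∧-true yσ
  ...     | y_y , ι′y≡ιx = LabelledBijection-extend xₓ y_y (sym (fibre-label ι′ ι′y≡ιx))
                             (fibre-counts-bijection ι ι′ k (X ─ x) (Y ─ y) ∣X─x∣≡k
                               (FibreCountsAgree-remove ι ι′ xₓ y_y (sym (fibre-label ι′ ι′y≡ιx)) agree))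
    where
    ∣X─x∣≡k : countFin (X ─ x) ≡ k
    ∣X─x∣≡k = suc-injective (begin
      suc (countFin (X ─ x))                      ≡⟨ +-comm 1 _ ⟩
      countFin (X ─ x) + 1                        ≡⟨ cong (λ b → countFin (X ─ x) + (if b then 1 else 0)) xₓ ⟨
      countFin (X ─ x) + (if X x then 1 else 0)   ≡⟨ countFin-remove X x ⟨
      countFin X                                  ≡⟨ ∣X∣≡1+k ⟩
      suc k                                       ∎)
      where open ≡-Reasoning

  fibre-counts-agree : ∀ {m m′} (ι : Fin m → A) (ι′ : Fin m′ → A) X Y →
                       (∀ v → X v ≡ true → FibreCountsAgree ι ι′ X Y (ι v)) →
                       (∀ w → Y w ≡ true → FibreCountsAgree ι ι′ X Y (ι′ w)) → ∀ σ → FibreCountsAgree ι ι′ X Y σ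
  fibre-counts-agree ι ι′ X Y on-X on-Y σ with witness-or-empty (X ∩ fibre _≟ᴬ_ ι σ)
  ... | inj₁ (v , p) = subst (FibreCountsAgree ι ι′ X Y) (fibre-label ι (proj₂ (∧-true p))) (on-X v (proj₁ (∧-true p)))
  ... | inj₂ none-in-X with witness-or-empty (Y ∩ fibre _≟ᴬ_ ι′ σ)
  ...   | inj₁ (w , p) = subst (FibreCountsAgree ι ι′ X Y) (fibre-label ι′ (proj₂ (∧-true p))) (on-Y w (proj₁ (∧-true p)))
  ...   | inj₂ none-in-Y = trans (countFin-empty none-in-X) (sym (countFin-empty none-in-Y))

  fibre-counts-agree-or-differ : ∀ {m m′} (ι : Fin m → A) (ι′ : Fin m′ → A) X Y →
                                 (∀ σ → FibreCountsAgree ι ι′ X Y σ) ⊎ ∃[ σ ] ¬ FibreCountsAgree ι ι′ X Y σ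
  fibre-counts-agree-or-differ ι ι′ X Y
    with ⊆-or-witness X (λ v → agrees? (ι v)) | ⊆-or-witness Y (λ w → agrees? (ι′ w))
    where
    agrees? : A → Bool
    agrees? σ = does (countFin (X ∩ fibre _≟ᴬ_ ι σ) ≟ countFin (Y ∩ fibre _≟ᴬ_ ι′ σ))
  ... | inj₂ (v , _ , disagree) | _ = inj₂ (ι v , does-false (_ ≟ _) disagree)
  ... | inj₁ _ | inj₂ (w , _ , disagree) = inj₂ (ι′ w , does-false (_ ≟ _) disagree)
  ... | inj₁ X-agrees | inj₁ Y-agrees =
    inj₁ (fibre-counts-agree ι ι′ X Y (λ v → does-true (_ ≟ _) ∘ X-agrees v) (λ w → does-true (_ ≟ _) ∘ Y-agrees w))

opposite-≢ : (e : Fin 2) → opposite e ≢ e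
opposite-≢ zero ()
opposite-≢ (suc zero) ()

assign-self : ∀ {k} {A : Set} (col : Fin k → A) c S → assign col c S c ≡ S
assign-self col c S with c ≟ᶠ c
... | yes _ = refl
... | no c≢c = ⊥-elim (c≢c refl)

assign-other : ∀ {k} {A : Set} (col : Fin k → A) c S {d} → d ≢ c → assign col c S d ≡ col d
assign-other col c S {d} d≢c with d ≟ᶠ c
... | yes d≡c = ⊥-elim (d≢c d≡c)
... | no _ = refl

module _ {G H : Digraph} where

  record Marks (p : Position 2 G H) (e : Fin 2) (X : Subset G) (Y : Subset H) : Set where
    constructor marks
    field
      marksᴳ : ∀ v → g p e v ≡ X v
      marksᴴ : ∀ w → h p e w ≡ Y w

  SamePalette : Position 2 G H → Fin (n G) → Fin (n H) → Set
  SamePalette p v w = ∀ c → g p c v ≡ h p c w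

  marks-agree : ∀ {p e X Y v w} → Marks p e X Y → SamePalette p v w → X v ≡ Y w
  marks-agree {e = e} {v = v} {w} (marks mᴳ mᴴ) same = trans (sym (mᴳ v)) (trans (same e) (mᴴ w))

  marks-after-other : ∀ {p e X Y} σ S T → Marks p e X Y → Marks (play p (opposite e) σ S T) e X Y
  marks-after-other {p} {e} inG S T (marks mᴳ mᴴ) =
    marks (λ v → trans (cong (λ Z → Z v) (assign-other (g p) (opposite e) S (opposite-≢ e ∘ sym))) (mᴳ v))
          (λ w → trans (cong (λ Z → Z w) (assign-other (h p) (opposite e) T (opposite-≢ e ∘ sym))) (mᴴ w))
  marks-after-other {p} {e} inH S T (marks mᴳ mᴴ) =
    marks (λ v → trans (cong (λ Z → Z v) (assign-other (g p) (opposite e) T (opposite-≢ e ∘ sym))) (mᴳ v))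
          (λ w → trans (cong (λ Z → Z w) (assign-other (h p) (opposite e) S (opposite-≢ e ∘ sym))) (mᴴ w))

  marks-play-inG : ∀ p c S T → Marks (play p c inG S T) c S T
  marks-play-inG p c S T = marks (λ v → cong (λ Z → Z v) (assign-self (g p) c S))
                                 (λ w → cong (λ Z → Z w) (assign-self (h p) c T))

  marks-play-inH : ∀ p c S T → Marks (play p c inH S T) c T S
  marks-play-inH p c S T = marks (λ v → cong (λ Z → Z v) (assign-self (g p) c T))
                                 (λ w → cong (λ Z → Z w) (assign-self (h p) c S))

  win-C1-G : ∀ {p} v → (∀ w → SamePalette p v w → ⊥) → ∀Wins p
  win-C1-G {p} v absent =
    now (inj₁ ((λ c → g p c v) , inj₂ ((v , λ _ → refl) , λ (w , pal) → absent w (λ c → sym (pal c)))))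

  win-C1-H : ∀ {p} w → (∀ v → SamePalette p v w → ⊥) → ∀Wins p
  win-C1-H {p} w absent =
    now (inj₁ ((λ c → h p c w) , inj₁ ((λ (v , pal) → absent v pal) , (w , λ _ → refl))))

  win-C2-G : ∀ {p} v₁ v₂ → E G v₁ v₂ ≡ true →
             (∀ w₁ w₂ → SamePalette p v₁ w₁ → SamePalette p v₂ w₂ → E H w₁ w₂ ≡ true → ⊥) → ∀Wins p
  win-C2-G {p} v₁ v₂ edge absent =
    now (inj₂ ((λ c → g p c v₁) , (λ c → g p c v₂) , inj₁ ((v₁ , v₂ , (λ _ → refl) , (λ _ → refl) , edge) ,
      λ (w₁ , w₂ , pal₁ , pal₂ , edge′) → absent w₁ w₂ (λ c → sym (pal₁ c)) (λ c → sym (pal₂ c)) edge′)))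

  win-C2-H : ∀ {p} w₁ w₂ → E H w₁ w₂ ≡ true →
             (∀ v₁ v₂ → SamePalette p v₁ w₁ → SamePalette p v₂ w₂ → E G v₁ v₂ ≡ true → ⊥) → ∀Wins p
  win-C2-H {p} w₁ w₂ edge absent =
    now (inj₂ ((λ c → h p c w₁) , (λ c → h p c w₂) , inj₂ (
      (λ (v₁ , v₂ , pal₁ , pal₂ , edge′) → absent v₁ v₂ pal₁ pal₂ edge′) ,
      (w₁ , w₂ , (λ _ → refl) , (λ _ → refl) , edge))))

  win-C1-G-by : ∀ {p e f X Y X′ Y′} → Marks p e X Y → Marks p f X′ Y′ →
                ∀ v → (∀ w → X v ≡ Y w → X′ v ≡ Y′ w → ⊥) → ∀Wins p
  win-C1-G-by mₑ m_f v absent = win-C1-G v λ w pal → absent w (marks-agree mₑ pal) (marks-agree m_f pal)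

  win-C1-H-by : ∀ {p e f X Y X′ Y′} → Marks p e X Y → Marks p f X′ Y′ →
                ∀ w → (∀ v → X v ≡ Y w → X′ v ≡ Y′ w → ⊥) → ∀Wins p
  win-C1-H-by mₑ m_f w absent = win-C1-H w λ v pal → absent v (marks-agree mₑ pal) (marks-agree m_f pal)

marks-cong : ∀ {G H} {q : Position 2 G H} {e X Y Y′} → Marks q e X Y → Y ≐ Y′ → Marks q e X Y′
marks-cong (marks mᴳ mᴴ) Y≐Y′ = marks mᴳ (λ w → trans (mᴴ w) (Y≐Y′ w))

Winning : (G H : Digraph) → Subset G → Subset H → Set
Winning G H X Y = ∀ (p : Position 2 G H) e → Marks p e X Y → ∀Wins p

swap : ∀ {k G H} → Position k G H → Position k H G
swap p = pos (h p) (g p)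

∀Wins-swap : ∀ {G H} {q : Position 2 H G} → ∀Wins q → ∀Wins (swap q)
∀Wins-swap (now (inj₁ (P , inj₁ (a , b)))) = now (inj₁ (P , inj₂ (b , a)))
∀Wins-swap (now (inj₁ (P , inj₂ (a , b)))) = now (inj₁ (P , inj₁ (b , a)))
∀Wins-swap (now (inj₂ (P₁ , P₂ , inj₁ (a , b)))) = now (inj₂ (P₁ , P₂ , inj₂ (b , a)))
∀Wins-swap (now (inj₂ (P₁ , P₂ , inj₂ (a , b)))) = now (inj₂ (P₁ , P₂ , inj₁ (b , a)))
∀Wins-swap (move c inG S next) = move c inH S λ T → ∀Wins-swap (next T)
∀Wins-swap (move c inH S next) = move c inG S λ T → ∀Wins-swap (next T)

Winning-swap : ∀ {G H X Y} → Winning H G Y X → Winning G H X Y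
Winning-swap win p e (marks mᴳ mᴴ) = ∀Wins-swap (win (swap p) e (marks mᴴ mᴳ))

-- Sets of different size

module _ {G H : Digraph} where

  -- ∀ marks a subset Z ⊆ Y with |Z| = |X| by the free colour; unless ∃ answers by some C ⊊ X, which hands
  -- the smaller pair (C, Z) to the induction, an element of C ∖ X or of Y ∖ Z violates (C1).
  count-<-step : {X : Subset G} {Y : Subset H} →
                 (∀ (C : Subset G) (Z : Subset H) → countFin C < countFin X → countFin C < countFin Z →
                   Winning G H C Z) →
                 countFin X < countFin Y → Winning G H X Y
  count-<-step {X} {Y} smaller ∣X∣<∣Y∣ p e mₑ = move f inH Z respond
    where
    f = opposite e
    chosen = subset-of-size Y (countFin X) (<⇒≤ ∣X∣<∣Y∣)
    Z = proj₁ chosen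
    Z⊆Y = proj₁ (proj₂ chosen)
    ∣Z∣≡∣X∣ = proj₂ (proj₂ chosen)

    old : ∀ C → Marks (play p f inH Z C) e X Y
    old C = marks-after-other inH Z C mₑ
    new : ∀ C → Marks (play p f inH Z C) f C Z
    new C = marks-play-inH p f Z C

    respond : (C : Subset G) → ∀Wins (play p f inH Z C)
    respond C with ⊆-or-witness C X | ⊆-or-witness X C
    ... | inj₂ (v , cᵥ , xᵥ) | _ = win-C1-G-by (old C) (new C) v λ w xᵥ≡yw cᵥ≡zw →
            true≢false (Z⊆Y w (trans (sym cᵥ≡zw) cᵥ)) (trans (sym xᵥ≡yw) xᵥ)
    ... | inj₁ C⊆X | inj₂ (v , xᵥ , cᵥ) = smaller C Z ∣C∣<∣X∣ (subst (countFin C <_) (sym ∣Z∣≡∣X∣) ∣C∣<∣X∣) _ f (new C)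
      where
      ∣C∣<∣X∣ = countFin-strict C⊆X v cᵥ xᵥ
    ... | inj₁ C⊆X | inj₁ X⊆C with ⊆-or-witness Y Z
    ...   | inj₁ Y⊆Z = ⊥-elim (<-irrefl refl (≤-<-trans (subst (countFin Y ≤_) ∣Z∣≡∣X∣ (countFin-mono Y⊆Z)) ∣X∣<∣Y∣))
    ...   | inj₂ (w , yw , zw) = win-C1-H-by (old C) (new C) w λ v xᵥ≡yw cᵥ≡zw →
            true≢false (X⊆C v (trans xᵥ≡yw yw)) (trans cᵥ≡zw zw)

  count-<-Winning : (k : ℕ) (X : Subset G) (Y : Subset H) →
                    countFin X ≤ k → countFin X < countFin Y → Winning G H X Y
  count-<-Winning zero X Y ∣X∣≤0 = count-<-step λ C Z ∣C∣<∣X∣ _ → ⊥-elim (n≮0 (≤-trans ∣C∣<∣X∣ ∣X∣≤0))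
  count-<-Winning (suc k) X Y ∣X∣≤k =
    count-<-step λ C Z ∣C∣<∣X∣ → count-<-Winning k C Z (≤-pred (≤-trans ∣C∣<∣X∣ ∣X∣≤k))

count-≢-Winning : ∀ {G H} {X : Subset G} {Y : Subset H} → countFin X ≢ countFin Y → Winning G H X Y
count-≢-Winning {X = X} {Y} ∣X∣≢∣Y∣ with <-cmp (countFin X) (countFin Y)
... | tri< ∣X∣<∣Y∣ _ _ = count-<-Winning (countFin X) X Y ≤-refl ∣X∣<∣Y∣
... | tri≈ _ ∣X∣≡∣Y∣ _ = ⊥-elim (∣X∣≢∣Y∣ ∣X∣≡∣Y∣)
... | tri> _ _ ∣Y∣<∣X∣ = Winning-swap (count-<-Winning (countFin Y) Y X ≤-refl ∣Y∣<∣X∣)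

-- The neighbourhood operators

Arc : (G : Digraph) → Dir → Fin (n G) → Fin (n G) → Bool
Arc G O u v = E G u v
Arc G I u v = E G v u

Arc-loop : ∀ G d a → Arc G d a a ≡ E G a a
Arc-loop G O a = refl
Arc-loop G I a = refl

η-unfold : ∀ G d (S : Subset G) v → η G d S v ≡ (S v ∨ anyFin (λ u → S u ∧ Arc G d u v))
η-unfold G O S v = refl
η-unfold G I S v = refl

η-⊇ : ∀ G d (S : Subset G) → S ⊆ η G d S
η-⊇ G d S v sᵥ rewrite η-unfold G d S v | sᵥ = refl

η-arc : ∀ G d (S : Subset G) {u v} → S u ≡ true → Arc G d u v ≡ true → η G d S v ≡ true
η-arc G d S {u} {v} sᵤ arc rewrite η-unfold G d S v with S v
... | true = refl
... | false = anyFin-intro _ u (∧-intro sᵤ arc)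

η-new : ∀ G d (S : Subset G) v → η G d S v ≡ true → S v ≡ false → ∃[ u ] (S u ≡ true × Arc G d u v ≡ true)
η-new G d S v ηSᵥ sᵥ rewrite η-unfold G d S v | sᵥ with anyFin-elim _ ηSᵥ
... | u , p = u , ∧-true p

module _ {G H : Digraph} where

  win-C2-H-arc : ∀ {q : Position 2 G H} d w₁ w₂ → Arc H d w₁ w₂ ≡ true →
                 (∀ v₁ v₂ → SamePalette q v₁ w₁ → SamePalette q v₂ w₂ → Arc G d v₁ v₂ ≡ true → ⊥) → ∀Wins q
  win-C2-H-arc O w₁ w₂ arc absent = win-C2-H w₁ w₂ arc absent
  win-C2-H-arc I w₁ w₂ arc absent = win-C2-H w₂ w₁ arc λ v₂ v₁ pal₂ pal₁ → absent v₁ v₂ pal₁ pal₂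

  -- A vertex of η_d Y ∖ B is refuted by (C1) if it lies in Y, and otherwise by (C2) along the arc
  -- that put it into η_d Y.
  η-response : ∀ d {q : Position 2 G H} {e f X Y B} → Marks q e X Y → Marks q f (η G d X) B →
               η H d Y ⊆ B ⊎ ∀Wins q
  η-response d {X = X} {Y} {B} mₑ m_f with ⊆-or-witness (η H d Y) B
  ... | inj₁ ηY⊆B = inj₁ ηY⊆B
  ... | inj₂ (u , ηYᵤ , bᵤ) with Y u in yᵤ
  ...   | true = inj₂ (win-C1-H-by mₑ m_f u λ v xᵥ≡yᵤ ηXᵥ≡bᵤ →
                    true≢false (η-⊇ G d X v (trans xᵥ≡yᵤ yᵤ)) (trans ηXᵥ≡bᵤ bᵤ))
  ...   | false with η-new H d Y u ηYᵤ yᵤ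
  ...     | y , y∈Y , arc = inj₂ (win-C2-H-arc d y u arc λ v₁ v₂ pal₁ pal₂ arc′ →
                    true≢false (η-arc G d X (trans (marks-agree mₑ pal₁) y∈Y) arc′)
                               (trans (marks-agree m_f pal₂) bᵤ))

η-response′ : ∀ {G H} d {q : Position 2 G H} {e f X Y A} → Marks q e X Y → Marks q f A (η H d Y) →
              η G d X ⊆ A ⊎ ∀Wins q
η-response′ d (marks mᴳ mᴴ) (marks m_fᴳ m_fᴴ) with η-response d (marks mᴴ mᴳ) (marks m_fᴴ m_fᴳ)
... | inj₁ ηX⊆A = inj₁ ηX⊆A
... | inj₂ win = inj₂ (∀Wins-swap win)

η-count-<-Winning : ∀ {G H} d {X : Subset G} {Y : Subset H} →
                    countFin (η H d Y) < countFin (η G d X) → Winning G H X Y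
η-count-<-Winning {G} {H} d {X} {Y} ∣ηY∣<∣ηX∣ p e mₑ = move f inH (η H d Y) respond
  where
  f = opposite e
  new : ∀ A → Marks (play p f inH (η H d Y) A) f A (η H d Y)
  new A = marks-play-inH p f (η H d Y) A
  respond : (A : Subset G) → ∀Wins (play p f inH (η H d Y) A)
  respond A with η-response′ d (marks-after-other inH (η H d Y) A mₑ) (new A)
  ... | inj₂ won = won
  ... | inj₁ ηX⊆A = count-≢-Winning ∣A∣≢∣ηY∣ _ f (new A)
    where
    ∣A∣≢∣ηY∣ : countFin A ≢ countFin (η H d Y)
    ∣A∣≢∣ηY∣ ∣A∣≡∣ηY∣ = <⇒≱ ∣ηY∣<∣ηX∣ (subst (countFin (η G d X) ≤_) ∣A∣≡∣ηY∣ (countFin-mono ηX⊆A))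

η-count-≢-Winning : ∀ {G H} d {X : Subset G} {Y : Subset H} →
                    countFin (η G d X) ≢ countFin (η H d Y) → Winning G H X Y
η-count-≢-Winning {G} {H} d {X} {Y} ∣ηX∣≢∣ηY∣ with <-cmp (countFin (η G d X)) (countFin (η H d Y))
... | tri< ∣ηX∣<∣ηY∣ _ _ = Winning-swap (η-count-<-Winning d ∣ηX∣<∣ηY∣)
... | tri≈ _ ∣ηX∣≡∣ηY∣ _ = ⊥-elim (∣ηX∣≢∣ηY∣ ∣ηX∣≡∣ηY∣)
... | tri> _ _ ∣ηY∣<∣ηX∣ = η-count-<-Winning d ∣ηY∣<∣ηX∣

η-Winning : ∀ {G H} d {X : Subset G} {Y : Subset H} → Winning G H (η G d X) (η H d Y) → Winning G H X Y
η-Winning {G} {H} d {X} {Y} win p e mₑ with countFin (η G d X) ≟ countFin (η H d Y)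
... | no ∣ηX∣≢∣ηY∣ = η-count-≢-Winning d ∣ηX∣≢∣ηY∣ p e mₑ
... | yes ∣ηX∣≡∣ηY∣ = move f inG (η G d X) respond
  where
  f = opposite e
  new : ∀ B → Marks (play p f inG (η G d X) B) f (η G d X) B
  new B = marks-play-inG p f (η G d X) B
  respond : (B : Subset H) → ∀Wins (play p f inG (η G d X) B)
  respond B with η-response d (marks-after-other inG (η G d X) B mₑ) (new B)
  ... | inj₂ won = won
  ... | inj₁ ηY⊆B with countFin B ≤? countFin (η H d Y)
  ...   | yes ∣B∣≤∣ηY∣ = win _ f (marks-cong (new B) (λ w → sym (⊆-count-≐ ηY⊆B ∣B∣≤∣ηY∣ w)))
  ...   | no ∣B∣≰∣ηY∣ = count-≢-Winning (λ ∣ηX∣≡∣B∣ → ∣B∣≰∣ηY∣ (≤-reflexive (trans (sym ∣ηX∣≡∣B∣) ∣ηX∣≡∣ηY∣)))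
                          _ f (new B)

ηseq-Winning : ∀ {G H} s {X : Subset G} {Y : Subset H} → Winning G H (ηseq G s X) (ηseq H s Y) → Winning G H X Y
ηseq-Winning [] win = win
ηseq-Winning (d ∷ s) win = η-Winning d (ηseq-Winning s win)

Separating : ∀ {A : Set} (G H : Digraph) → (Fin (n G) → A) → (Fin (n H) → A) → Set
Separating G H ιᴳ ιᴴ = ∀ a b → ιᴳ a ≢ ιᴴ b → Winning G H ⁅ a ⁆ ⁅ b ⁆

Separating-swap : ∀ {A : Set} {G H} {ιᴳ : Fin (n G) → A} {ιᴴ : Fin (n H) → A} →
                  Separating G H ιᴳ ιᴴ → Separating H G ιᴴ ιᴳ
Separating-swap sep b a ιb≢ιa = Winning-swap (sep a b (ιb≢ιa ∘ sym))

-- ∀ marks {a} by the free colour: the only answers not refuted at once are singletons {b} with b ∈ T,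
-- and the label of b differs from that of a.
isolated-label-wins : ∀ {A : Set} {G H} {ιᴳ : Fin (n G) → A} {ιᴴ : Fin (n H) → A} → Separating G H ιᴳ ιᴴ →
                      ∀ {q : Position 2 G H} {f S T} a → Marks q f S T → S a ≡ true →
                      (∀ w → T w ≡ true → ιᴳ a ≢ ιᴴ w) → ∀Wins q
isolated-label-wins {G = G} {H} {ιᴳ} {ιᴴ} sep {q} {f} {S} {T} a m_f sₐ unmatched = move e inG ⁅ a ⁆ respond
  where
  e = opposite f
  new : ∀ D → Marks (play q e inG ⁅ a ⁆ D) e ⁅ a ⁆ D
  new D = marks-play-inG q e ⁅ a ⁆ D
  respond : (D : Subset H) → ∀Wins (play q e inG ⁅ a ⁆ D)
  respond D with ⊆-or-witness D T
  ... | inj₂ (w , d_w , tw) = win-C1-H-by (new D) (marks-after-other inG ⁅ a ⁆ D m_f) w λ v ⁅a⁆ᵥ≡dw sᵥ≡tw →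
          true≢false (subst (λ u → S u ≡ true) (sym (⁅⁆-true (trans ⁅a⁆ᵥ≡dw d_w))) sₐ) (trans sᵥ≡tw tw)
  ... | inj₁ D⊆T with countFin D ≟ 1
  ...   | no ∣D∣≢1 = count-≢-Winning (λ ∣⁅a⁆∣≡∣D∣ → ∣D∣≢1 (trans (sym ∣⁅a⁆∣≡∣D∣) (countFin-⁅⁆ a))) _ e (new D)
  ...   | yes ∣D∣≡1 with singleton-of-count-1 D ∣D∣≡1
  ...     | b , d_b , ⁅b⁆≐D = sep a b (unmatched b (D⊆T b d_b)) _ e (marks-cong (new D) (sym ∘ ⁅b⁆≐D))

module _ {A : Set} (_≟ᴬ_ : DecidableEquality A) where

  -- ∃ must answer Y ∩ ι⁻¹σ by a subset of X of the same size, which therefore leaves ι⁻¹σ.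
  fibre-count-<-Winning : ∀ {G H} {ιᴳ : Fin (n G) → A} {ιᴴ : Fin (n H) → A} → Separating G H ιᴳ ιᴴ →
                          ∀ {X Y} σ → countFin (X ∩ fibre _≟ᴬ_ ιᴳ σ) < countFin (Y ∩ fibre _≟ᴬ_ ιᴴ σ) →
                          Winning G H X Y
  fibre-count-<-Winning {G} {H} {ιᴳ} {ιᴴ} sep {X} {Y} σ ∣Xσ∣<∣Yσ∣ p e mₑ = move f inH Yσ respond
    where
    f = opposite e
    Xσ = X ∩ fibre _≟ᴬ_ ιᴳ σ
    Yσ = Y ∩ fibre _≟ᴬ_ ιᴴ σ
    new : ∀ S → Marks (play p f inH Yσ S) f S Yσ
    new S = marks-play-inH p f Yσ S
    respond : (S : Subset G) → ∀Wins (play p f inH Yσ S)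
    respond S with ⊆-or-witness S X
    ... | inj₂ (v , sᵥ , xᵥ) = win-C1-G-by (marks-after-other inH Yσ S mₑ) (new S) v λ w xᵥ≡yw sᵥ≡yσw →
            true≢false (proj₁ (∧-true (trans (sym sᵥ≡yσw) sᵥ))) (trans (sym xᵥ≡yw) xᵥ)
    ... | inj₁ S⊆X with countFin S ≟ countFin Yσ
    ...   | no ∣S∣≢∣Yσ∣ = count-≢-Winning ∣S∣≢∣Yσ∣ _ f (new S)
    ...   | yes ∣S∣≡∣Yσ∣ with ⊆-or-witness S (fibre _≟ᴬ_ ιᴳ σ)
    ...     | inj₁ S⊆fibre = ⊥-elim (<-irrefl refl (<-≤-trans ∣Xσ∣<∣Yσ∣
                               (subst (_≤ countFin Xσ) ∣S∣≡∣Yσ∣ (countFin-mono λ i sᵢ → ∧-intro (S⊆X i sᵢ) (S⊆fibre i sᵢ)))))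
    ...     | inj₂ (a , sₐ , off) = isolated-label-wins sep a (new S) sₐ λ w yσw ιa≡ιw →
                                       does-false (ιᴳ a ≟ᴬ σ) off (trans ιa≡ιw (fibre-label _≟ᴬ_ ιᴴ (proj₂ (∧-true yσw))))

  fibre-count-≢-Winning : ∀ {G H} {ιᴳ : Fin (n G) → A} {ιᴴ : Fin (n H) → A} → Separating G H ιᴳ ιᴴ →
                          ∀ {X Y} σ → countFin (X ∩ fibre _≟ᴬ_ ιᴳ σ) ≢ countFin (Y ∩ fibre _≟ᴬ_ ιᴴ σ) →
                          Winning G H X Y
  fibre-count-≢-Winning {ιᴳ = ιᴳ} {ιᴴ} sep {X} {Y} σ counts≢
    with <-cmp (countFin (X ∩ fibre _≟ᴬ_ ιᴳ σ)) (countFin (Y ∩ fibre _≟ᴬ_ ιᴴ σ))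
  ... | tri< lt _ _ = fibre-count-<-Winning sep σ lt
  ... | tri≈ _ eq _ = ⊥-elim (counts≢ eq)
  ... | tri> _ _ gt = Winning-swap (fibre-count-<-Winning (Separating-swap sep) σ gt)

-- Distinguishing vertices by their tallies

η-⁅⁆-count : ∀ G d (K : Subset G) a → K a ≡ true →
             countFin (η G d ⁅ a ⁆ ∩ K) ≡ suc (countFin ((K ∩ Arc G d a) ─ a))
η-⁅⁆-count G d K a kₐ = begin
  countFin (η G d ⁅ a ⁆ ∩ K)                                         ≡⟨ countFin-remove (η G d ⁅ a ⁆ ∩ K) a ⟩
  countFin ((η G d ⁅ a ⁆ ∩ K) ─ a) + (if (η G d ⁅ a ⁆ ∩ K) a then 1 else 0)
    ≡⟨ cong₂ _+_ (countFin-cong away-from-a)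
                 (cong (λ b → if b then 1 else 0) (∧-intro (η-⊇ G d ⁅ a ⁆ a (⁅⁆-self a)) kₐ)) ⟩
  countFin ((K ∩ Arc G d a) ─ a) + 1                                  ≡⟨ +-comm _ 1 ⟩
  suc (countFin ((K ∩ Arc G d a) ─ a))                                ∎
  where
  open ≡-Reasoning
  away-from-a : (η G d ⁅ a ⁆ ∩ K) ─ a ≐ (K ∩ Arc G d a) ─ a
  away-from-a v rewrite η-unfold G d ⁅ a ⁆ v | anyFin-⁅⁆ a (λ u → Arc G d u v) with ⁅ a ⁆ v
  ... | true = trans (∧-zeroʳ _) (sym (∧-zeroʳ _))
  ... | false = cong (_∧ true) (∧-comm (Arc G d a v) (K v))

CountSeparating : (G H : Digraph) → Subset G → Subset H → Set
CountSeparating G H Kᴳ Kᴴ = ∀ X Y → countFin (X ∩ Kᴳ) ≢ countFin (Y ∩ Kᴴ) → Winning G H X Y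

module _ {G H : Digraph} {Kᴳ : Subset G} {Kᴴ : Subset H} {a : Fin (n G)} {b : Fin (n H)}
         (kₐ : Kᴳ a ≡ true) (k_b : Kᴴ b ≡ true) (loops : E G a a ≡ E H b b) where

  arc-count-from-η : ∀ d → countFin (η G d ⁅ a ⁆ ∩ Kᴳ) ≡ countFin (η H d ⁅ b ⁆ ∩ Kᴴ) →
                     countFin (Kᴳ ∩ Arc G d a) ≡ countFin (Kᴴ ∩ Arc H d b)
  arc-count-from-η d ∣η⁅a⁆∣≡∣η⁅b⁆∣ = begin
    countFin (Kᴳ ∩ Arc G d a)                                              ≡⟨ countFin-remove (Kᴳ ∩ Arc G d a) a ⟩
    countFin ((Kᴳ ∩ Arc G d a) ─ a) + (if Kᴳ a ∧ Arc G d a a then 1 else 0)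
      ≡⟨ cong₂ _+_ away-equal (cong (λ ℓ → if ℓ then 1 else 0) on-a) ⟩
    countFin ((Kᴴ ∩ Arc H d b) ─ b) + (if Kᴴ b ∧ Arc H d b b then 1 else 0) ≡⟨ countFin-remove (Kᴴ ∩ Arc H d b) b ⟨
    countFin (Kᴴ ∩ Arc H d b)                                              ∎
    where
    open ≡-Reasoning
    away-equal : countFin ((Kᴳ ∩ Arc G d a) ─ a) ≡ countFin ((Kᴴ ∩ Arc H d b) ─ b)
    away-equal = suc-injective (trans (sym (η-⁅⁆-count G d Kᴳ a kₐ)) (trans ∣η⁅a⁆∣≡∣η⁅b⁆∣ (η-⁅⁆-count H d Kᴴ b k_b)))
    on-a : Kᴳ a ∧ Arc G d a a ≡ Kᴴ b ∧ Arc H d b b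
    on-a = cong₂ _∧_ (trans kₐ (sym k_b)) (trans (Arc-loop G d a) (trans loops (sym (Arc-loop H d b))))

-- No move is needed: the loop at a joins two vertices with the palette of a, and in H only b has it.
loop-Winning : ∀ {G H} a b → E G a a ≡ true → E H b b ≡ false → Winning G H ⁅ a ⁆ ⁅ b ⁆
loop-Winning {H = H} a b loopₐ no-loop_b p e mₑ = win-C2-G a a loopₐ λ w₁ w₂ pal₁ pal₂ edge →
  true≢false (subst₂ (λ u v → E H u v ≡ true) (is-b pal₁) (is-b pal₂) edge) no-loop_b
  where
  is-b : ∀ {w} → SamePalette p a w → w ≡ b
  is-b pal = ⁅⁆-true (trans (sym (marks-agree mₑ pal)) (⁅⁆-self a))

loop-≢-Winning : ∀ {G H} a b → E G a a ≢ E H b b → Winning G H ⁅ a ⁆ ⁅ b ⁆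
loop-≢-Winning {G} {H} a b loops≢ with E G a a in ℓₐ | E H b b in ℓ_b
... | true | true = ⊥-elim (loops≢ refl)
... | false | false = ⊥-elim (loops≢ refl)
... | true | false = loop-Winning a b ℓₐ ℓ_b
... | false | true = Winning-swap (loop-Winning b a ℓ_b ℓₐ)

-- The first component of τ counts in-neighbours, the arcs of η_I; the second out-neighbours, those of η_O.
tally-Winning : ∀ {G H} {Kᴳ : Subset G} {Kᴴ : Subset H} → CountSeparating G H Kᴳ Kᴴ →
                ∀ {a b} → Kᴳ a ≡ true → Kᴴ b ≡ true → τ G Kᴳ a ≢ τ H Kᴴ b → Winning G H ⁅ a ⁆ ⁅ b ⁆
tally-Winning {G} {H} {Kᴳ} {Kᴴ} sep {a} {b} kₐ k_b τ≢ with E G a a ≟ᵇ E H b b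
... | no loops≢ = loop-≢-Winning a b loops≢
... | yes loops with countFin (Kᴳ ∩ Arc G I a) ≟ countFin (Kᴴ ∩ Arc H I b)
...   | no in≢ = η-Winning I (sep _ _ (in≢ ∘ arc-count-from-η {G} {H} {Kᴳ} {Kᴴ} kₐ k_b loops I))
...   | yes in≡ = η-Winning O (sep _ _ λ ∣η⁅a⁆∣≡∣η⁅b⁆∣ →
                    τ≢ (cong₂ _,_ in≡ (arc-count-from-η {G} {H} {Kᴳ} {Kᴴ} kₐ k_b loops O ∣η⁅a⁆∣≡∣η⁅b⁆∣)))

everything-CountSeparating : ∀ {G H} → CountSeparating G H (λ _ → true) (λ _ → true)
everything-CountSeparating X Y ∣X∣≢∣Y∣ =
  count-≢-Winning λ ∣X∣≡∣Y∣ →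
    ∣X∣≢∣Y∣ (trans (countFin-cong (∧-identityʳ ∘ X)) (trans ∣X∣≡∣Y∣ (sym (countFin-cong (∧-identityʳ ∘ Y)))))

history-Separating : ∀ k G H → Separating G H (history G k) (history H k)
history-Separating zero G H a b h≢ = tally-Winning everything-CountSeparating refl refl (h≢ ∘ cong (_∷ []))
history-Separating (suc k) G H a b h≢ with history G k a ≟ₜ history H k b
... | no hₖ≢ = history-Separating k G H a b hₖ≢
... | yes hₖ≡ = tally-Winning class-CountSeparating (dec-true (history G k a ≟ₜ history G k a) refl)
                  (dec-true (history H k b ≟ₜ history H k b) refl) (λ τ≡ → h≢ (cong₂ _∷_ τ≡ hₖ≡))
  where
  class-CountSeparating : CountSeparating G H (classOf G k a) (classOf H k b)
  -- classOf G k a is, by definition, the fibre of history G k over history G k a.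
  class-CountSeparating X Y counts≢ = fibre-count-≢-Winning _≟ₜ_ (history-Separating k G H) (history G k a)
    (subst (λ σ → countFin (X ∩ classOf G k a) ≢ countFin (Y ∩ fibre _≟ₜ_ (history H k) σ)) (sym hₖ≡) counts≢)

-- Stabilisation of the tally histories

τ-cong : ∀ G {Y Y′ : Subset G} v → Y ≐ Y′ → τ G Y v ≡ τ G Y′ v
τ-cong G v Y≐Y′ = cong₂ _,_ (countFin-cong λ u → cong (_∧ _) (Y≐Y′ u)) (countFin-cong λ u → cong (_∧ _) (Y≐Y′ u))

history-head : ∀ {G H v w} k → history G k v ≡ history H k w → tallySeq G v k ≡ tallySeq H w k
history-head zero = ∷-injectiveˡ
history-head (suc k) = ∷-injectiveˡ

history-prefix : ∀ {G H v w k} j → k ≤ j → history G j v ≡ history H j w → history G k v ≡ history H k w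
history-prefix zero z≤n eq = eq
history-prefix (suc j) k≤1+j eq with m≤n⇒m<n∨m≡n k≤1+j
... | inj₂ refl = eq
... | inj₁ (s≤s k≤j) = history-prefix j k≤j (∷-injectiveʳ eq)

module _ (G : Digraph) where

  Stable : ℕ → Set
  Stable k = ∀ u v → history G k u ≡ history G k v → history G (suc k) u ≡ history G (suc k) v

  classOf-suc-⊆ : ∀ k u → classOf G (suc k) u ⊆ classOf G k u
  classOf-suc-⊆ k u w same =
    dec-true (history G k w ≟ₜ history G k u)
             (∷-injectiveʳ (does-true (history G (suc k) w ≟ₜ history G (suc k) u) same))

  classOf-stable : ∀ {k} → Stable k → ∀ u → classOf G (suc k) u ≐ classOf G k u
  classOf-stable {k} st u = ⊆-count-≐ (classOf-suc-⊆ k u)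
    (countFin-mono {X = classOf G k u} λ w same → dec-true (_ ≟ₜ _) (st w u (does-true (_ ≟ₜ _) same)))

  Stable-suc : ∀ {k} → Stable k → Stable (suc k)
  Stable-suc st u v eq = cong₂ _∷_
    (trans (τ-cong G u (classOf-stable st u)) (trans (∷-injectiveˡ eq) (sym (τ-cong G v (classOf-stable st v))))) eq

  Stable-mono : ∀ {j k} → j ≤′ k → Stable j → Stable k
  Stable-mono ≤′-refl st = st
  Stable-mono (≤′-step j≤′k) st = Stable-suc (Stable-mono j≤′k st)

  tallySeq-stable : ∀ {j k} → Stable j → j ≤′ k → ∀ v → tallySeq G v (suc k) ≡ tallySeq G v (suc j)
  tallySeq-stable st ≤′-refl v = refl
  tallySeq-stable st (≤′-step j≤′k) v =
    trans (τ-cong G v (classOf-stable (Stable-mono j≤′k st) v)) (tallySeq-stable st j≤′k v)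

  classSizes : ℕ → ℕ
  classSizes k = sumFin λ u → countFin (classOf G k u)

  Stable-or-shrinks : ∀ k → Stable k ⊎ classSizes (suc k) < classSizes k
  Stable-or-shrinks k with all? (λ u → ⊆-dec (classOf G k u) (classOf G (suc k) u))
  ... | yes kept = inj₁ λ u v eq → does-true (_ ≟ₜ _) (kept v u (dec-true (_ ≟ₜ _) eq))
  ... | no split with ¬∀⟶∃¬ _ _ (λ u → ⊆-dec (classOf G k u) (classOf G (suc k) u)) split
  ...   | u , ¬kept with ⊆-or-witness (classOf G k u) (classOf G (suc k) u)
  ...     | inj₁ kept = ⊥-elim (¬kept kept)
  ...     | inj₂ (w , inₖ , outₖ₊₁) = inj₂ (sumFin-strict (λ u′ → countFin-mono (classOf-suc-⊆ k u′)) u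
                                              (countFin-strict (classOf-suc-⊆ k u) w outₖ₊₁ inₖ))

  Stable-by-or-shrinks : ∀ k → (∃[ j ] (j ≤ k × Stable j)) ⊎ classSizes k + k ≤ classSizes 0
  Stable-by-or-shrinks zero = inj₂ (≤-reflexive (+-identityʳ _))
  Stable-by-or-shrinks (suc k) with Stable-by-or-shrinks k
  ... | inj₁ (j , j≤k , st) = inj₁ (j , m≤n⇒m≤1+n j≤k , st)
  ... | inj₂ bound with Stable-or-shrinks k
  ...   | inj₁ st = inj₁ (k , n≤1+n k , st)
  ...   | inj₂ shrinks = inj₂ (begin
    classSizes (suc k) + suc k   ≡⟨ +-suc (classSizes (suc k)) k ⟩
    suc (classSizes (suc k)) + k ≤⟨ +-monoˡ-≤ k shrinks ⟩
    classSizes k + k             ≤⟨ bound ⟩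
    classSizes 0                 ∎)
    where open ≤-Reasoning

  stabilisation-index : ℕ
  stabilisation-index = suc (n G * n G)

  -- classSizes decreases strictly until the partition into history classes stabilises, and classSizes 0 ≤ n².
  Stable-at-index : Stable stabilisation-index
  Stable-at-index with Stable-by-or-shrinks stabilisation-index
  ... | inj₁ (j , j≤i , st) = Stable-mono (≤⇒≤′ j≤i) st
  ... | inj₂ bound = ⊥-elim (<-irrefl refl (≤-trans (m≤n+m stabilisation-index _)
                       (≤-trans bound (sumFin-≤ _ (n G) λ u → countFin-≤ (classOf G 0 u)))))

tallies-from-history : ∀ {G H K} → Stable G K → Stable H K → ∀ {v w} →
                       history G (suc K) v ≡ history H (suc K) w → ∀ k → tallySeq G v k ≡ tallySeq H w k
tallies-from-history {G} {H} {K} stᴳ stᴴ {v} {w} eq zero =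
  history-head {G} {H} {v} {w} zero (history-prefix (suc K) z≤n eq)
tallies-from-history {G} {H} {K} stᴳ stᴴ {v} {w} eq (suc k) with k ≤? K
... | yes k≤K = history-head (suc k) (history-prefix (suc K) (s≤s k≤K) eq)
... | no k≰K = begin
  tallySeq G v (suc k)   ≡⟨ tallySeq-stable G stᴳ K≤′k v ⟩
  tallySeq G v (suc K)   ≡⟨ history-head (suc K) eq ⟩
  tallySeq H w (suc K)   ≡⟨ tallySeq-stable H stᴴ K≤′k w ⟨
  tallySeq H w (suc k)   ∎
  where
  open ≡-Reasoning
  K≤′k = ≤⇒≤′ (≰⇒≥ k≰K)

common-stable-index : ∀ G H → ∃[ K ] (Stable G K × Stable H K)
common-stable-index G H =
  stabilisation-index G + stabilisation-index H ,
  Stable-mono G (≤⇒≤′ (m≤m+n (stabilisation-index G) _)) (Stable-at-index G) ,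
  Stable-mono H (≤⇒≤′ (m≤n+m (stabilisation-index H) (stabilisation-index G))) (Stable-at-index H)

same-fibre-counts-SameSpectrum : ∀ {G H K} {X : Subset G} {Y : Subset H} → Stable G K → Stable H K →
                                 (∀ σ → FibreCountsAgree _≟ₜ_ (history G (suc K)) (history H (suc K)) X Y σ) →
                                 SameSpectrum G X H Y
same-fibre-counts-SameSpectrum {G} {H} {K} {X} {Y} stᴳ stᴴ agree
  with fibre-counts-bijection _≟ₜ_ (history G (suc K)) (history H (suc K)) (countFin X) X Y refl agree
... | f , labels = ↔⇒⤖ f , λ a → tallies-from-history stᴳ stᴴ (labels a)

spectrum-Winning : ∀ {G H} {X : Subset G} {Y : Subset H} → ¬ SameSpectrum G X H Y → Winning G H X Y
spectrum-Winning {G} {H} {X} {Y} different with common-stable-index G H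
... | K , stᴳ , stᴴ with fibre-counts-agree-or-differ _≟ₜ_ (history G (suc K)) (history H (suc K)) X Y
...   | inj₁ agree = ⊥-elim (different (same-fibre-counts-SameSpectrum stᴳ stᴴ agree))
...   | inj₂ (σ , differ) = fibre-count-≢-Winning _≟ₜ_ (history-Separating (suc K) G H) σ differ

corollary4p7 : (G H : Digraph) (p : Position 2 G H) (c : Fin 2) (σ : Side)
               (S : SetIn σ G H) (T : SetOther σ G H) (s : List Dir) →
               SpectraDiffer σ G H s S T →
               ∀Wins (play p c σ S T)
corollary4p7 G H p c inG S T s differ =
  ηseq-Winning s (spectrum-Winning differ) (play p c inG S T) c (marks-play-inG p c S T)
corollary4p7 G H p c inH S T s differ =
  Winning-swap (ηseq-Winning s (spectrum-Winning differ)) (play p c inH S T) c (marks-play-inH p c S T)
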